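{- Let $\pi \in S_n$ and let $f=(\tau_1,\ldots,\tau_r)$ be a minimal transitive star factorization of $\pi$. Let $\sigma$ and $\hat\sigma$ be distinct cycles of $\pi$, and suppose there are indices $a<c<b$ such that $\tau_a$ and $\tau_b$ meet $\sigma$ while $\tau_c$ meets $\hat\sigma$. Then $\hat\sigma$ does not contain the symbol $1$, and every index $j$ such that $\tau_j$ meets $\hat\sigma$ satisfies $a<j<b$.
   Context: A star transposition in $S_n$ is a transposition $(1\,i)$ with $2\le i\le n$. Permutations are multiplied as functions, $\rho\sigma(j)=\rho(\sigma(j))$. A star factorization of $\pi\in S_n$ of length $r$ is an ordered list $(\tau_1,\ldots,\tau_r)$ of star transpositions with $\tau_1\cdots\tau_r=\pi$; it is transitive if the group generated by its factors acts transitively on $\{1,\ldots,n\}$. If $\pi$ has $m$ cycles (counting fixed points), a minimal transitive star factorization of $\pi$ is a transitive star factorization of length $n+m-2$. A star transposition $(1\,i)$ meets the cycle $\sigma$ of $\pi$ if $\sigma$ contains the symbol $i$. -}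

module Defs where

open import Data.Nat using (ℕ; zero; suc; _≤_; _≤?_)
open import Data.Fin using (Fin; toℕ; _≟_) renaming (zero to fzero; suc to fsuc)
open import Data.Fin.Properties using (all?)
open import Data.Fin.Permutation using (Permutation′; _⟨$⟩ʳ_)
open import Data.List using (List; []; _∷_; length; filter; allFin)
open import Data.List.Membership.Propositional using (_∈_)
open import Data.Product using (∃)
open import Relation.Binary.PropositionalEquality using (_≡_)
open import Relation.Nullary using (Dec; yes; no)
open import Relation.Unary using (Decidable)

-- Symbols {1,…,N} are represented by Fin N; the symbol 1 is Fin.zero.

star : ∀ {N} → Fin (suc N) → Fin (suc N) → Fin (suc N)
star i j with j ≟ fzero
... | yes _ = i
... | no _ with j ≟ i
...   | yes _ = fzero
...   | no _ = j

-- A star factorization is given by the list of indices i of its factors (1 i).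
-- Product τ₁ ⋯ τᵣ as functions: (τ₁ ⋯ τᵣ)(j) = τ₁(τ₂(⋯ τᵣ(j))).
prod : ∀ {N} → List (Fin (suc N)) → Fin (suc N) → Fin (suc N)
prod [] j = j
prod (i ∷ is) j = star i (prod is j)

iter : ∀ {N} → Permutation′ N → ℕ → Fin N → Fin N
iter π zero j = j
iter π (suc t) j = π ⟨$⟩ʳ (iter π t j)

SameCycle : ∀ {N} → Permutation′ N → Fin N → Fin N → Set
SameCycle π x y = ∃ λ t → iter π t x ≡ y

-- j is the smallest symbol of its cycle (the orbit of j is {π^t j : t < N}).
IsCycleMin : ∀ {N} → Permutation′ N → Fin N → Set
IsCycleMin {N} π j = ∀ (t : Fin N) → toℕ j ≤ toℕ (iter π (toℕ t) j)

isCycleMin? : ∀ {N} (π : Permutation′ N) → Decidable (IsCycleMin π)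
isCycleMin? π j = all? (λ t → toℕ j ≤? toℕ (iter π (toℕ t) j))

-- Number of cycles of π, counting fixed points (one minimal symbol per cycle).
numCycles : ∀ {N} → Permutation′ N → ℕ
numCycles {N} π = length (filter (isCycleMin? π) (allFin N))

-- Orbit relation of the group generated by the factors (1 i), i ∈ f.
-- Since every generator is an involution, the generated group equals the
-- generated monoid, so reachability by applying generators is its orbit relation.
data Reach {N} (f : List (Fin (suc N))) (x : Fin (suc N)) : Fin (suc N) → Set where
  here : Reach f x x
  step : ∀ {y i} → Reach f x y → i ∈ f → Reach f x (star i y)

Transitive : ∀ {N} → List (Fin (suc N)) → Set
Transitive {N} f = ∀ (x y : Fin (suc N)) → Reach f x y

Meets : ∀ {N} → Permutation′ N → Fin N → Fin N → Set
Meets π i x = SameCycle π x i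

-- Build the product from the right, one factor (1 x) at a time. Left multiplication by
-- (1 x) joins the cycles of 1 and x when they differ and cuts their common cycle
-- otherwise, so the weight "number of cycles + 2 · number of distinct symbols used" grows
-- by at most one per factor, and drops when a factor repeats a symbol off the cycle of 1.
-- Transitivity makes every symbol other than 1 occur, so a minimal factorization attains
-- the resulting bound on the weight, which leaves no room for a drop: every factor either
-- introduces a new symbol (a join) or cuts the cycle of 1.
-- For such factorizations induction along the same process maintains the invariant
-- Nested: the symbols on the cycle of 1 occur once each and the product sends each of
-- them to an earlier factor, and a cycle met by a factor lying between two factors of
-- another cycle avoids 1 and has all its factors between those two. A join only adds
-- the fresh symbol x to the cycle of 1; a cut splits off as the cycle of x exactly the
-- factors of the old cycle of 1 lying between the two occurrences of x.

{-# OPTIONS --safe #-}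
module Submission where

open import Defs

open import Data.Empty using (⊥-elim)
open import Data.Fin using (Fin; toℕ; fromℕ<; _≟_; _≤_; _<_; _≤?_) renaming (zero to fzero; suc to fsuc)
open import Data.Fin.Permutation using (Permutation′; _⟨$⟩ʳ_)
open import Data.Fin.Properties using (pigeonhole; toℕ<n; toℕ-fromℕ<; toℕ-injective; any?; all?; ¬∀⟶∃¬)
open import Data.List using (List; []; _∷_; length; lookup; filter; allFin; tabulate)
open import Data.List.Membership.Propositional using (_∈_; _∉_)
open import Data.List.Membership.Propositional.Properties using (∈-allFin; ∈-lookup)
import Data.List.Membership.DecPropositional as DecMembership
open import Data.List.Properties
  using (length-filter; length-tabulate; filter-none; filter-some; filter-reject; filter-all)
open import Data.List.Relation.Unary.All as All using (All; []; _∷_)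
open import Data.List.Relation.Unary.All.Properties using (tabulate⁺)
open import Data.List.Relation.Unary.AllPairs using ([]; _∷_)
open import Data.List.Relation.Unary.Any as Any using (here; there)
open import Data.List.Relation.Unary.Any.Properties using (lookup-index)
open import Data.List.Relation.Unary.Unique.Propositional using (Unique)
open import Data.List.Relation.Unary.Unique.Propositional.Properties using (allFin⁺)
open import Data.Nat as ℕ using (ℕ; zero; suc; _+_; _*_; _∸_; z≤n; s≤s)
open import Data.Nat.DivMod using (_%_; _/_; m≡m%n+[m/n]*n; m%n<n)
open import Data.Nat.Properties
  using ( ≤-refl; ≤-reflexive; ≤-trans; ≤-antisym; ≤-pred; <-trans; ≤-<-trans; <-≤-trans; <-irrefl
        ; <⇒≤; <⇒≱; ≰⇒>; n<1+n; m≤n⇒m≤1+n; n≤0⇒n≡0; m≤m+n; m∸n+n≡m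
        ; +-suc; +-comm; *-comm; *-suc; +-mono-≤; +-monoˡ-≤; +-monoʳ-<; module ≤-Reasoning )
open import Data.Nat.Tactic.RingSolver using (solve-∀)
open import Data.Product as Product using (∃; _×_; _,_; proj₁; proj₂)
open import Data.Sum as Sum using (_⊎_; inj₁; inj₂; [_,_]′)
open import Function using (id; _∘_)
open import Function.Definitions using (Injective)
import Function.Endo.Propositional as Endo
open import Relation.Binary.PropositionalEquality
  using (_≡_; _≢_; refl; sym; trans; cong; subst; module ≡-Reasoning)
open import Relation.Nullary using (¬_; ¬?; Dec; yes; no; contradiction)
open import Relation.Unary using (Decidable)

count : {A : Set} {P : A → Set} → Decidable P → List A → ℕ
count P? xs = length (filter P? xs)

module _ {A : Set} {P Q : A → Set} (P? : Decidable P) (Q? : Decidable Q) where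

  count-mono : ∀ {xs} → All (λ y → P y → Q y) xs → count P? xs ℕ.≤ count Q? xs
  count-mono {[]}     []           = z≤n
  count-mono {x ∷ xs} (P⇒Q ∷ P⇒Qs) with P? x | Q? x
  ... | yes _  | yes _   = s≤s (count-mono P⇒Qs)
  ... | yes px | no ¬qx  = contradiction (P⇒Q px) ¬qx
  ... | no _   | yes _   = m≤n⇒m≤1+n (count-mono P⇒Qs)
  ... | no _   | no _    = count-mono P⇒Qs

  count-< : (∀ {y} → P y → Q y) → ∀ {y xs} → y ∈ xs → Q y → ¬ P y →
            count P? xs ℕ.< count Q? xs
  count-< P⇒Q {xs = x ∷ xs} (here refl) qx ¬px with P? x | Q? x
  ... | yes px | _      = contradiction px ¬px
  ... | no _   | yes _  = s≤s (count-mono {xs} (All.tabulate λ _ → P⇒Q))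
  ... | no _   | no ¬qx = contradiction qx ¬qx
  count-< P⇒Q {xs = x ∷ xs} (there y∈xs) qy ¬py
    with count-< P⇒Q y∈xs qy ¬py | P? x | Q? x
  ... | ih | yes _  | yes _  = s≤s ih
  ... | _  | yes px | no ¬qx = contradiction (P⇒Q px) ¬qx
  ... | ih | no _   | yes _  = m≤n⇒m≤1+n ih
  ... | ih | no _   | no _   = ih

  count-≤-suc : ∀ {μ} → (∀ {y} → P y → Q y ⊎ y ≡ μ) → ∀ {xs} → Unique xs →
                count P? xs ℕ.≤ suc (count Q? xs)
  count-≤-suc P⇒Q⊎μ {[]}     []               = z≤n
  count-≤-suc P⇒Q⊎μ {x ∷ xs} (x∉xs ∷ unique) with count-≤-suc P⇒Q⊎μ unique | P? x | Q? x
  ... | ih | yes _  | yes _  = s≤s ih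
  ... | ih | no _   | yes _  = m≤n⇒m≤1+n ih
  ... | ih | no _   | no _   = ih
  ... | _  | yes px | no ¬qx with P⇒Q⊎μ px
  ...   | inj₁ qx   = contradiction qx ¬qx
  ...   | inj₂ refl = s≤s (count-mono (All.map avoids-μ x∉xs))
    where
      avoids-μ : ∀ {y} → x ≢ y → P y → Q y
      avoids-μ x≢y py = [ id , (λ y≡x → contradiction (sym y≡x) x≢y) ]′ (P⇒Q⊎μ py)

-- Orbits of an endofunction

infixr 8 _^_
_^_ : {A : Set} → (A → A) → ℕ → A → A
_^_ {A} = Endo._^_ A

Orbit : {A : Set} → (A → A) → A → A → Set
Orbit g y z = ∃ λ t → (g ^ t) y ≡ z

^-+ : {A : Set} (g : A → A) → ∀ s t y → (g ^ (s + t)) y ≡ (g ^ s) ((g ^ t) y)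
^-+ {A} g s t y = cong (λ h → h y) (Endo.^-homo A g s t)

^-suc : {A : Set} (g : A → A) → ∀ t y → (g ^ suc t) y ≡ (g ^ t) (g y)
^-suc g zero    y = refl
^-suc g (suc t) y = cong g (^-suc g t y)

module _ {A : Set} {g : A → A} where

  orbit-refl : ∀ {y} → Orbit g y y
  orbit-refl = 0 , refl

  orbit-step : ∀ {y z} → g y ≡ z → Orbit g y z
  orbit-step gy≡z = 1 , gy≡z

  orbit-trans : ∀ {x y z} → Orbit g x y → Orbit g y z → Orbit g x z
  orbit-trans {x} (s , refl) (t , refl) = t + s , ^-+ g t s x

  orbit-closed : (S : A → Set) → (∀ {w} → S w → S (g w)) → ∀ {y z} → S y → Orbit g y z → S z
  orbit-closed S g-closed {y} Sy (t , refl) = go t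
    where
      go : ∀ t → S ((g ^ t) y)
      go zero    = Sy
      go (suc t) = g-closed (go t)

  orbit-of-fixed : ∀ {y z} → g y ≡ y → Orbit g y z → z ≡ y
  orbit-of-fixed gy≡y = orbit-closed (_≡ _) (λ w≡y → trans (cong g w≡y) gy≡y) refl

module _ {N : ℕ} {g : Fin N → Fin N} (g-inj : Injective _≡_ _≡_ g) where

  ^-injective : ∀ t → Injective _≡_ _≡_ (g ^ t)
  ^-injective zero    e = e
  ^-injective (suc t) e = ^-injective t (g-inj e)

  period : ∀ y → ∃ λ p → (g ^ suc p) y ≡ y × suc p ℕ.≤ N
  period y with pigeonhole (n<1+n N) (λ i → (g ^ toℕ i) y)
  ... | i , j , i<j , gⁱy≡gʲy = p , ^-injective (toℕ i) gⁱgᵖy≡gⁱy , p<N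
    where
      open ≡-Reasoning
      p : ℕ
      p = toℕ j ∸ suc (toℕ i)
      p+i≡j : suc p + toℕ i ≡ toℕ j
      p+i≡j = trans (sym (+-suc p (toℕ i))) (m∸n+n≡m i<j)
      gⁱgᵖy≡gⁱy : (g ^ toℕ i) ((g ^ suc p) y) ≡ (g ^ toℕ i) y
      gⁱgᵖy≡gⁱy = begin
        (g ^ toℕ i) ((g ^ suc p) y)  ≡⟨ ^-+ g (toℕ i) (suc p) y ⟨
        (g ^ (toℕ i + suc p)) y      ≡⟨ cong (λ k → (g ^ k) y) (trans (+-comm (toℕ i) (suc p)) p+i≡j) ⟩
        (g ^ toℕ j) y                ≡⟨ gⁱy≡gʲy ⟨
        (g ^ toℕ i) y                ∎
      p<N : suc p ℕ.≤ N
      p<N = ≤-trans (subst (suc p ℕ.≤_) p+i≡j (m≤m+n (suc p) (toℕ i))) (≤-pred (toℕ<n j))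

  ^-period-multiple : ∀ {y} p → (g ^ suc p) y ≡ y → ∀ k → (g ^ (k * suc p)) y ≡ y
  ^-period-multiple p gᵖy≡y zero    = refl
  ^-period-multiple {y} p gᵖy≡y (suc k) = begin
    (g ^ (suc p + k * suc p)) y    ≡⟨ ^-+ g (suc p) (k * suc p) y ⟩
    (g ^ suc p) ((g ^ (k * suc p)) y) ≡⟨ cong (g ^ suc p) (^-period-multiple p gᵖy≡y k) ⟩
    (g ^ suc p) y                  ≡⟨ gᵖy≡y ⟩
    y                              ∎
    where open ≡-Reasoning

  orbit-bounded : ∀ {y z} → Orbit g y z → ∃ λ (t : Fin N) → (g ^ toℕ t) y ≡ z
  orbit-bounded {y} (t , refl) with period y
  ... | p , gᵖy≡y , p<N = fromℕ< r<N , trans (cong (λ k → (g ^ k) y) (toℕ-fromℕ< r<N)) (sym gʳy≡gᵗy)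
    where
      open ≡-Reasoning
      r : ℕ
      r = t % suc p
      r<N : r ℕ.< N
      r<N = <-≤-trans (m%n<n t (suc p)) p<N
      gʳy≡gᵗy : (g ^ t) y ≡ (g ^ r) y
      gʳy≡gᵗy = begin
        (g ^ t) y                               ≡⟨ cong (λ k → (g ^ k) y) (m≡m%n+[m/n]*n t (suc p)) ⟩
        (g ^ (r + (t / suc p) * suc p)) y       ≡⟨ ^-+ g r ((t / suc p) * suc p) y ⟩
        (g ^ r) ((g ^ ((t / suc p) * suc p)) y) ≡⟨ cong (g ^ r) (^-period-multiple p gᵖy≡y (t / suc p)) ⟩
        (g ^ r) y                               ∎

  orbit-sym : ∀ {y z} → Orbit g y z → Orbit g z y
  orbit-sym {y} (t , refl) with period y
  ... | p , gᵖy≡y , _ = p * t , (begin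
    (g ^ (p * t)) ((g ^ t) y) ≡⟨ ^-+ g (p * t) t y ⟨
    (g ^ (p * t + t)) y       ≡⟨ cong (λ k → (g ^ k) y) pt+t≡t[1+p] ⟩
    (g ^ (t * suc p)) y       ≡⟨ ^-period-multiple p gᵖy≡y t ⟩
    y                         ∎)
    where
      open ≡-Reasoning
      pt+t≡t[1+p] : p * t + t ≡ t * suc p
      pt+t≡t[1+p] = trans (+-comm (p * t) t) (trans (cong (t +_) (*-comm p t)) (sym (*-suc t p)))

  orbit? : ∀ y z → Dec (Orbit g y z)
  orbit? y z with any? (λ (t : Fin N) → (g ^ toℕ t) y ≟ z)
  ... | yes (t , gᵗy≡z) = yes (toℕ t , gᵗy≡z)
  ... | no ¬bounded     = no (¬bounded ∘ orbit-bounded)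

IsOrbitMin : ∀ {N} → (Fin N → Fin N) → Fin N → Set
IsOrbitMin {N} g y = ∀ (t : Fin N) → y ≤ (g ^ toℕ t) y

isOrbitMin? : ∀ {N} (g : Fin N → Fin N) → Decidable (IsOrbitMin g)
isOrbitMin? g y = all? λ t → y ≤? (g ^ toℕ t) y

cycleCount : ∀ {N} → (Fin N → Fin N) → ℕ
cycleCount {N} g = count (isOrbitMin? g) (allFin N)

cycleCount-≤ : ∀ {N} (g : Fin N → Fin N) → cycleCount g ℕ.≤ N
cycleCount-≤ {N} g = ≤-trans (length-filter (isOrbitMin? g) (allFin N)) (≤-reflexive (length-tabulate id))

module _ {N : ℕ} {g : Fin N → Fin N} where

  orbitMin-intro : ∀ {y} → (∀ {z} → Orbit g y z → y ≤ z) → IsOrbitMin g y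
  orbitMin-intro y≤ t = y≤ (toℕ t , refl)

  orbitMin-exists : ∀ y → ∃ λ μ → Orbit g y μ × IsOrbitMin g μ
  orbitMin-exists y = descend (suc (toℕ y)) y ≤-refl
    where
      descend : ∀ k y → toℕ y ℕ.< k → ∃ λ μ → Orbit g y μ × IsOrbitMin g μ
      descend (suc k) y y<k with isOrbitMin? g y
      ... | yes min = y , orbit-refl , min
      ... | no ¬min with ¬∀⟶∃¬ N _ (λ t → y ≤? (g ^ toℕ t) y) ¬min
      ...   | t , y≰gᵗy with descend k ((g ^ toℕ t) y) (≤-trans (≰⇒> y≰gᵗy) (≤-pred y<k))
      ...     | μ , gᵗy~μ , min = μ , orbit-trans (toℕ t , refl) gᵗy~μ , min

  module _ (g-inj : Injective _≡_ _≡_ g) where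

    orbitMin-≤ : ∀ {y z} → IsOrbitMin g y → Orbit g y z → y ≤ z
    orbitMin-≤ min y~z with orbit-bounded g-inj y~z
    ... | t , refl = min t

    orbitMin-unique : ∀ {y z} → IsOrbitMin g y → IsOrbitMin g z → Orbit g y z → y ≡ z
    orbitMin-unique y-min z-min y~z =
      toℕ-injective (≤-antisym (orbitMin-≤ y-min y~z) (orbitMin-≤ z-min (orbit-sym g-inj y~z)))

-- Star transpositions

star-self : ∀ {n} (i : Fin (suc n)) → star i i ≡ fzero
star-self i with i ≟ fzero
... | yes i≡0 = i≡0
... | no _ with i ≟ i
...   | yes _   = refl
...   | no i≢i  = contradiction refl i≢i

star-fixes : ∀ {n} {i j : Fin (suc n)} → j ≢ fzero → j ≢ i → star i j ≡ j
star-fixes {i = i} {j} j≢0 j≢i with j ≟ fzero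
... | yes j≡0 = contradiction j≡0 j≢0
... | no _ with j ≟ i
...   | yes j≡i = contradiction j≡i j≢i
...   | no _    = refl

data StarView {n} (i j : Fin (suc n)) : Set where
  at-one : j ≡ fzero → star i j ≡ i → StarView i j
  at-i   : j ≡ i → star i j ≡ fzero → StarView i j
  fixed  : j ≢ fzero → j ≢ i → star i j ≡ j → StarView i j

star-view : ∀ {n} (i j : Fin (suc n)) → StarView i j
star-view i j with j ≟ fzero | j ≟ i
... | yes refl | _        = at-one refl refl
... | no j≢0   | yes refl = at-i refl (star-self i)
... | no j≢0   | no j≢i   = fixed j≢0 j≢i (star-fixes j≢0 j≢i)

star-involutive : ∀ {n} (i j : Fin (suc n)) → star i (star i j) ≡ j
star-involutive i j with star-view i j
... | at-one refl sj≡i = trans (cong (star i) sj≡i) (star-self i)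
... | at-i refl sj≡0   = cong (star i) sj≡0
... | fixed _ _ sj≡j   = trans (cong (star i) sj≡j) sj≡j

star-injective : ∀ {n} (i : Fin (suc n)) → Injective _≡_ _≡_ (star i)
star-injective i {j} {k} e = trans (sym (star-involutive i j)) (trans (cong (star i) e) (star-involutive i k))

prod-injective : ∀ {n} (xs : List (Fin (suc n))) → Injective _≡_ _≡_ (prod xs)
prod-injective []       e = e
prod-injective (i ∷ xs) e = prod-injective xs (star-injective i e)

prod-fixes : ∀ {n} {y : Fin (suc n)} (xs : List (Fin (suc n))) → y ≢ fzero → y ∉ xs → prod xs y ≡ y
prod-fixes []       _   _    = refl
prod-fixes (i ∷ xs) y≢0 y∉xs =
  trans (cong (star i) (prod-fixes xs y≢0 (y∉xs ∘ there))) (star-fixes y≢0 (y∉xs ∘ here))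

module _ {n : ℕ} {f g : Fin (suc n) → Fin (suc n)} {x : Fin (suc n)}
         (g≗ : ∀ y → g y ≡ star x (f y)) where

  -- g = (1 x) ∘ f agrees with f except that it sends f⁻¹(1) to x and f⁻¹(x) to 1.
  orbit-after-star : ∀ {y z} → Orbit f y z → Orbit g y z ⊎ Orbit g y fzero ⊎ Orbit g y x
  orbit-after-star (t , fᵗy≡z) = follow t fᵗy≡z
    where
      follow : ∀ t {y z} → (f ^ t) y ≡ z → Orbit g y z ⊎ Orbit g y fzero ⊎ Orbit g y x
      follow zero    fᵗy≡z = inj₁ (0 , fᵗy≡z)
      follow (suc t) {y} fᵗy≡z with star-view x (f y)
      ... | at-one _ sfy≡x  = inj₂ (inj₂ (orbit-step (trans (g≗ y) sfy≡x)))
      ... | at-i _ sfy≡0    = inj₂ (inj₁ (orbit-step (trans (g≗ y) sfy≡0)))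
      ... | fixed _ _ sfy≡fy =
        Sum.map via-fy (Sum.map via-fy via-fy) (follow t (trans (sym (^-suc f t y)) fᵗy≡z))
        where
          via-fy : ∀ {w} → Orbit g (f y) w → Orbit g y w
          via-fy = orbit-trans (orbit-step (trans (g≗ y) sfy≡fy))

module LeftStar {n : ℕ} (P : Fin (suc n) → Fin (suc n)) (P-inj : Injective _≡_ _≡_ P)
                (x : Fin (suc n)) where

  Q : Fin (suc n) → Fin (suc n)
  Q y = star x (P y)

  Q-inj : Injective _≡_ _≡_ Q
  Q-inj e = P-inj (star-injective x e)

  P-to-Q : ∀ {y z} → Orbit P y z → Orbit Q y z ⊎ Orbit Q y fzero ⊎ Orbit Q y x
  P-to-Q = orbit-after-star (λ _ → refl)

  Q-to-P : ∀ {y z} → Orbit Q y z → Orbit P y z ⊎ Orbit P y fzero ⊎ Orbit P y x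
  Q-to-P = orbit-after-star (λ y → sym (star-involutive x (P y)))

  away-P⇒Q : ∀ {y z} → ¬ Orbit P y fzero → ¬ Orbit P y x → Orbit P y z → Orbit Q y z
  away-P⇒Q y≁0 y≁x y~z with P-to-Q y~z
  ... | inj₁ y~z′        = y~z′
  ... | inj₂ (inj₁ y~0) = contradiction (Q-to-P y~0) [ y≁0 , [ y≁0 , y≁x ]′ ]′
  ... | inj₂ (inj₂ y~x) = contradiction (Q-to-P y~x) [ y≁x , [ y≁0 , y≁x ]′ ]′

  cycleCount-split : cycleCount Q ℕ.≤ suc (cycleCount P)
  cycleCount-split with orbitMin-exists {g = Q} x
  ... | μ , x~μ , μ-min = count-≤-suc (isOrbitMin? Q) (isOrbitMin? P) Qmin⇒Pmin (allFin⁺ (suc n))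
    where
      Qmin⇒Pmin : ∀ {y} → IsOrbitMin Q y → IsOrbitMin P y ⊎ y ≡ μ
      Qmin⇒Pmin {y} y-min with y ≟ μ
      ... | yes y≡μ = inj₂ y≡μ
      ... | no y≢μ  =
        inj₁ (orbitMin-intro λ y~z → [ orbitMin-≤ Q-inj y-min , [ via-one , via-x ]′ ]′ (P-to-Q y~z))
        where
          via-one : ∀ {z} → Orbit Q y fzero → y ≤ z
          via-one y~0 = ≤-trans (orbitMin-≤ Q-inj y-min y~0) z≤n
          via-x : ∀ {z} → Orbit Q y x → y ≤ z
          via-x y~x = contradiction (orbitMin-unique Q-inj y-min μ-min (orbit-trans y~x x~μ)) y≢μ

  returns-via-x : ∀ t {y} → (P ^ suc t) y ≡ fzero → Orbit Q y x ⊎ Orbit P y x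
  returns-via-x t {y} Pᵗy≡0 with star-view x (P y)
  ... | at-one _ Qy≡x = inj₁ (orbit-step Qy≡x)
  ... | at-i Py≡x _   = inj₂ (orbit-step Py≡x)
  returns-via-x zero    Py≡0 | fixed Py≢0 _ _ = contradiction Py≡0 Py≢0
  returns-via-x (suc t) {y} Pᵗy≡0 | fixed _ _ Qy≡Py =
    Sum.map (orbit-trans (orbit-step Qy≡Py)) (orbit-trans (orbit-step refl))
            (returns-via-x t (trans (sym (^-suc P (suc t) y)) Pᵗy≡0))

  module _ (0≁x : ¬ Orbit P fzero x) where

    x~one : Orbit Q x fzero
    x~one with period P-inj fzero
    ... | p , Pᵖ0≡0 , _ = orbit-sym Q-inj ([ id , (λ 0~x → contradiction 0~x 0≁x) ]′ (returns-via-x p Pᵖ0≡0))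

    x-cycle-joins-one : ∀ {y} → Orbit P y x → Orbit Q y fzero
    x-cycle-joins-one y~x = [ via-x , [ id , via-x ]′ ]′ (P-to-Q y~x)
      where
        via-x : ∀ {y} → Orbit Q y x → Orbit Q y fzero
        via-x y~x = orbit-trans y~x x~one

    cycleCount-merge : cycleCount Q ℕ.< cycleCount P
    cycleCount-merge with orbitMin-exists {g = P} x
    ... | μ , x~μ , μ-min = count-< (isOrbitMin? Q) (isOrbitMin? P) Qmin⇒Pmin (∈-allFin μ) μ-min μ-not-Qmin
      where
        Qmin⇒Pmin : ∀ {y} → IsOrbitMin Q y → IsOrbitMin P y
        Qmin⇒Pmin {y} y-min = orbitMin-intro λ y~z →
          [ orbitMin-≤ Q-inj y-min , [ via-one , (λ y~x → via-one (orbit-trans y~x x~one)) ]′ ]′ (P-to-Q y~z)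
          where
            via-one : ∀ {z} → Orbit Q y fzero → y ≤ z
            via-one y~0 = ≤-trans (orbitMin-≤ Q-inj y-min y~0) z≤n
        μ-not-Qmin : ¬ IsOrbitMin Q μ
        μ-not-Qmin μ-Qmin = 0≁x (subst (λ w → Orbit P w x) μ≡0 μ~x)
          where
            μ~x : Orbit P μ x
            μ~x = orbit-sym P-inj x~μ
            μ≡0 : μ ≡ fzero
            μ≡0 = toℕ-injective (n≤0⇒n≡0 (orbitMin-≤ Q-inj μ-Qmin (x-cycle-joins-one μ~x)))

-- Minimality forces every repeated factor to cut the cycle of 1

data RepeatsCut {n} : List (Fin (suc n)) → Set where
  []  : RepeatsCut []
  _∷_ : ∀ {x xs} → (x ∈ xs → Orbit (prod xs) fzero x) → RepeatsCut xs → RepeatsCut (x ∷ xs)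

module _ {n : ℕ} where
  open DecMembership (_≟_ {suc n}) using (_∈?_)

  support : List (Fin (suc n)) → ℕ
  support xs = count (_∈? xs) (allFin (suc n))

  weight : List (Fin (suc n)) → ℕ
  weight xs = cycleCount (prod xs) + (support xs + support xs)

  support-[] : support [] ≡ 0
  support-[] = cong length (filter-none (_∈? []) {allFin (suc n)} (All.tabulate λ _ ()))

  support-∷ : ∀ x (xs : List (Fin (suc n))) → support (x ∷ xs) ℕ.≤ suc (support xs)
  support-∷ x xs = count-≤-suc (_∈? (x ∷ xs)) (_∈? xs) new-or-old (allFin⁺ (suc n))
    where
      new-or-old : ∀ {y} → y ∈ x ∷ xs → y ∈ xs ⊎ y ≡ x
      new-or-old (here y≡x)   = inj₂ y≡x
      new-or-old (there y∈xs) = inj₁ y∈xs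

  support-∷-∈ : ∀ {x} {xs : List (Fin (suc n))} → x ∈ xs → support (x ∷ xs) ℕ.≤ support xs
  support-∷-∈ {x} {xs} x∈xs = count-mono (_∈? (x ∷ xs)) (_∈? xs) {allFin (suc n)} (All.tabulate λ _ → old)
    where
      old : ∀ {y} → y ∈ x ∷ xs → y ∈ xs
      old (here refl)  = x∈xs
      old (there y∈xs) = y∈xs

  private
    double-mono : ∀ {a b} → a ℕ.≤ b → a + a ℕ.≤ b + b
    double-mono a≤b = +-mono-≤ a≤b a≤b

    double-suc : ∀ c s → c + (suc s + suc s) ≡ suc (suc c) + (s + s)
    double-suc = solve-∀

  weight-∷ : ∀ {x} (xs : List (Fin (suc n))) → x ≢ fzero → weight (x ∷ xs) ℕ.≤ suc (weight xs)
  weight-∷ {x} xs x≢0 with x ∈? xs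
  ... | yes x∈xs = +-mono-≤ cycleCount-split (double-mono (support-∷-∈ x∈xs))
    where open LeftStar (prod xs) (prod-injective xs) x
  ... | no x∉xs  = begin
    cycleCount Q + (support (x ∷ xs) + support (x ∷ xs)) ≤⟨ +-mono-≤ ≤-refl (double-mono (support-∷ x xs)) ⟩
    cycleCount Q + (suc (support xs) + suc (support xs)) ≡⟨ double-suc (cycleCount Q) (support xs) ⟩
    suc (suc (cycleCount Q)) + (support xs + support xs) ≤⟨ +-monoˡ-≤ _ (s≤s (cycleCount-merge 0≁x)) ⟩
    suc (weight xs)                                      ∎
    where
      open ≤-Reasoning
      open LeftStar (prod xs) (prod-injective xs) x
      0≁x : ¬ Orbit (prod xs) fzero x
      0≁x 0~x = x≢0 (sym (orbit-of-fixed (prod-fixes xs x≢0 x∉xs) (orbit-sym (prod-injective xs) 0~x)))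

  weight-∷-repeated-join : ∀ {x} {xs : List (Fin (suc n))} → x ∈ xs → ¬ Orbit (prod xs) fzero x →
                           weight (x ∷ xs) ℕ.< weight xs
  weight-∷-repeated-join {x} {xs} x∈xs 0≁x =
    +-mono-≤ (cycleCount-merge 0≁x) (double-mono (support-∷-∈ x∈xs))
    where open LeftStar (prod xs) (prod-injective xs) x

  weight-≤ : ∀ {xs : List (Fin (suc n))} → All (_≢ fzero) xs → weight xs ℕ.≤ suc n + length xs
  weight-≤ {[]} [] = begin
    cycleCount (prod {n} []) + (support [] + support [])
      ≡⟨ cong (λ s → cycleCount (prod {n} []) + (s + s)) support-[] ⟩
    cycleCount (prod {n} []) + 0                         ≤⟨ +-monoˡ-≤ 0 (cycleCount-≤ (prod [])) ⟩
    suc n + 0                                            ∎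
    where open ≤-Reasoning
  weight-≤ {x ∷ xs} (x≢0 ∷ xs≢0) = begin
    weight (x ∷ xs)         ≤⟨ weight-∷ xs x≢0 ⟩
    suc (weight xs)         ≤⟨ s≤s (weight-≤ xs≢0) ⟩
    suc (suc n + length xs) ≡⟨ +-suc (suc n) (length xs) ⟨
    suc n + length (x ∷ xs) ∎
    where open ≤-Reasoning

  tight⇒repeatsCut : ∀ {xs : List (Fin (suc n))} → All (_≢ fzero) xs →
                     suc n + length xs ℕ.≤ weight xs → RepeatsCut xs
  tight⇒repeatsCut {[]}     []           _     = []
  tight⇒repeatsCut {x ∷ xs} (x≢0 ∷ xs≢0) tight = repeat-cuts ∷ tight⇒repeatsCut xs≢0 tight′
    where
      open ≤-Reasoning
      tight′ : suc n + length xs ℕ.≤ weight xs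
      tight′ = ≤-pred (begin
        suc (suc n + length xs) ≡⟨ +-suc (suc n) (length xs) ⟨
        suc n + length (x ∷ xs) ≤⟨ tight ⟩
        weight (x ∷ xs)         ≤⟨ weight-∷ xs x≢0 ⟩
        suc (weight xs)         ∎)
      repeat-cuts : x ∈ xs → Orbit (prod xs) fzero x
      repeat-cuts x∈xs with orbit? (prod-injective xs) fzero x
      ... | yes 0~x = 0~x
      ... | no 0≁x  = contradiction (begin-strict
        suc n + length (x ∷ xs) ≤⟨ tight ⟩
        weight (x ∷ xs)         <⟨ weight-∷-repeated-join x∈xs 0≁x ⟩
        weight xs               ≤⟨ weight-≤ xs≢0 ⟩
        suc n + length xs       <⟨ +-monoʳ-< (suc n) (n<1+n (length xs)) ⟩
        suc n + length (x ∷ xs) ∎) (<-irrefl refl)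

-- The nesting invariant

module _ {n : ℕ} where
  open DecMembership (_≟_ {suc n}) using (_∈?_)

  one-cycle⊆factors : ∀ (xs : List (Fin (suc n))) {y} → y ≢ fzero → Orbit (prod xs) y fzero → y ∈ xs
  one-cycle⊆factors xs {y} y≢0 y~0 with y ∈? xs
  ... | yes y∈xs = y∈xs
  ... | no y∉xs  = contradiction (sym (orbit-of-fixed (prod-fixes xs y≢0 y∉xs) y~0)) y≢0

  ShareCycle : (xs : List (Fin (suc n))) → Fin (length xs) → Fin (length xs) → Set
  ShareCycle xs j k = Orbit (prod xs) (lookup xs j) (lookup xs k)

  MeetsOne : (xs : List (Fin (suc n))) → Fin (length xs) → Set
  MeetsOne xs j = Orbit (prod xs) (lookup xs j) fzero

  record Nested (xs : List (Fin (suc n))) : Set where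
    field
      nested       : ∀ {a c b} → a < c → c < b → ShareCycle xs a b → ¬ ShareCycle xs a c →
                     ¬ MeetsOne xs c × (∀ j → ShareCycle xs c j → a < j × j < b)
      before-one   : ∀ {c b} → c < b → MeetsOne xs b → ¬ MeetsOne xs c →
                     ∀ j → ShareCycle xs c j → j < b
      one-distinct : ∀ {j k} → MeetsOne xs j → lookup xs j ≡ lookup xs k → j ≡ k
      one-descends : ∀ {j k} → MeetsOne xs j → prod xs (lookup xs j) ≡ lookup xs k → k < j

  nested-[] : Nested []
  nested-[] = record
    { nested = λ { {()} } ; before-one = λ { {()} } ; one-distinct = λ { {()} } ; one-descends = λ { {()} } }

module JoinStep {n : ℕ} {x : Fin (suc n)} {xs : List (Fin (suc n))}
                (x≢0 : x ≢ fzero) (xs≢0 : All (_≢ fzero) xs) (x∉xs : x ∉ xs) (ih : Nested xs) where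

  open Nested ih
  open LeftStar (prod xs) (prod-injective xs) x using (Q; Q-inj; P-to-Q; Q-to-P)

  private
    P : Fin (suc n) → Fin (suc n)
    P = prod xs
    P-inj : Injective _≡_ _≡_ P
    P-inj = prod-injective xs

  factor≢0 : ∀ k → lookup (x ∷ xs) k ≢ fzero
  factor≢0 k = All.lookup (x≢0 ∷ xs≢0) (∈-lookup k)

  factor≢x : ∀ k → lookup xs k ≢ x
  factor≢x k k≡x = x∉xs (subst (_∈ xs) k≡x (∈-lookup k))

  x-fixed : P x ≡ x
  x-fixed = prod-fixes xs x≢0 x∉xs

  Qx≡0 : Q x ≡ fzero
  Qx≡0 = trans (cong (star x) x-fixed) (star-self x)

  x~one : Orbit Q x fzero
  x~one = orbit-step Qx≡0

  ≁x : ∀ {w} → w ≢ x → ¬ Orbit P w x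
  ≁x w≢x w~x = w≢x (orbit-of-fixed x-fixed (orbit-sym P-inj w~x))

  one-P⇒Q : ∀ {w} → Orbit P w fzero → Orbit Q w fzero
  one-P⇒Q w~0 = [ id , [ id , (λ w~x → orbit-trans w~x x~one) ]′ ]′ (P-to-Q w~0)

  one-Q⇒P : ∀ {w} → w ≢ x → Orbit Q w fzero → Orbit P w fzero
  one-Q⇒P w≢x w~0 = [ id , [ id , ⊥-elim ∘ ≁x w≢x ]′ ]′ (Q-to-P w~0)

  P⇒Q : ∀ {w v} → w ≢ x → Orbit P w v → Orbit Q w v
  P⇒Q w≢x w~v with P-to-Q w~v
  ... | inj₁ w~v′   = w~v′
  ... | inj₂ w~0∨x = orbit-trans w~0 (orbit-sym Q-inj (one-P⇒Q v~0))
    where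
      w~0 : Orbit Q _ fzero
      w~0 = [ id , (λ w~x → orbit-trans w~x x~one) ]′ w~0∨x
      v~0 : Orbit P _ fzero
      v~0 = orbit-trans (orbit-sym P-inj w~v) (one-Q⇒P w≢x w~0)

  Q⇒P : ∀ {w v} → w ≢ x → v ≢ x → Orbit Q w v → Orbit P w v
  Q⇒P w≢x v≢x w~v with Q-to-P w~v
  ... | inj₁ w~v′       = w~v′
  ... | inj₂ (inj₁ w~0) =
    orbit-trans w~0 (orbit-sym P-inj (one-Q⇒P v≢x (orbit-trans (orbit-sym Q-inj w~v) (one-P⇒Q w~0))))
  ... | inj₂ (inj₂ w~x) = contradiction w~x (≁x w≢x)

  off-one-≁x : ∀ k → ¬ Orbit P (lookup xs k) fzero → ¬ Orbit Q (lookup xs k) x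
  off-one-≁x k k≁0 k~x = k≁0 (one-Q⇒P (factor≢x k) (orbit-trans k~x x~one))

  nested′ : ∀ {a c b} → a < c → c < b → ShareCycle (x ∷ xs) a b → ¬ ShareCycle (x ∷ xs) a c →
            ¬ MeetsOne (x ∷ xs) c × (∀ j → ShareCycle (x ∷ xs) c j → a < j × j < b)
  nested′ {fzero}  {fzero}           ()
  nested′ {fsuc _} {fzero}           ()
  nested′ {_}      {fsuc _} {fzero}  _ ()
  nested′ {a@fzero} {fsuc c} {fsuc b} _ (s≤s c<b) x~b x≁c = c≁0 ∘ one-Q⇒P (factor≢x c) , within
    where
      c≁0 : ¬ Orbit P (lookup xs c) fzero
      c≁0 c~0 = x≁c (orbit-trans x~one (orbit-sym Q-inj (one-P⇒Q c~0)))
      b~0 : Orbit P (lookup xs b) fzero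
      b~0 = one-Q⇒P (factor≢x b) (orbit-trans (orbit-sym Q-inj x~b) x~one)
      within : ∀ j → ShareCycle (x ∷ xs) (fsuc c) j → a < j × j < fsuc b
      within fzero    c~x = contradiction c~x (off-one-≁x c c≁0)
      within (fsuc j) c~j = s≤s z≤n , s≤s (before-one c<b b~0 c≁0 j (Q⇒P (factor≢x c) (factor≢x j) c~j))
  nested′ {fsuc a} {fsuc c} {fsuc b} (s≤s a<c) (s≤s c<b) a~b a≁c = c≁0 ∘ one-Q⇒P (factor≢x c) , within
    where
      c≁0,within : ¬ MeetsOne xs c × (∀ j → ShareCycle xs c j → a < j × j < b)
      c≁0,within = nested a<c c<b (Q⇒P (factor≢x a) (factor≢x b) a~b) (a≁c ∘ P⇒Q (factor≢x a))
      c≁0 : ¬ MeetsOne xs c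
      c≁0 = proj₁ c≁0,within
      within : ∀ j → ShareCycle (x ∷ xs) (fsuc c) j → fsuc a < j × j < fsuc b
      within fzero    c~x = contradiction c~x (off-one-≁x c c≁0)
      within (fsuc j) c~j = Product.map s≤s s≤s (proj₂ c≁0,within j (Q⇒P (factor≢x c) (factor≢x j) c~j))

  before-one′ : ∀ {c b} → c < b → MeetsOne (x ∷ xs) b → ¬ MeetsOne (x ∷ xs) c →
                ∀ j → ShareCycle (x ∷ xs) c j → j < b
  before-one′ {fzero}           _         _   x≁0 _        _   = contradiction x~one x≁0
  before-one′ {fsuc _} {fzero}  ()
  before-one′ {fsuc c} {fsuc b} (s≤s c<b) b~0 c≁0 fzero    c~x = contradiction (orbit-trans c~x x~one) c≁0
  before-one′ {fsuc c} {fsuc b} (s≤s c<b) b~0 c≁0 (fsuc j) c~j =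
    s≤s (before-one c<b (one-Q⇒P (factor≢x b) b~0) (c≁0 ∘ one-P⇒Q) j (Q⇒P (factor≢x c) (factor≢x j) c~j))

  one-distinct′ : ∀ {j k} → MeetsOne (x ∷ xs) j → lookup (x ∷ xs) j ≡ lookup (x ∷ xs) k → j ≡ k
  one-distinct′ {fzero}  {fzero}  _   _   = refl
  one-distinct′ {fzero}  {fsuc k} _   x≡k = contradiction (sym x≡k) (factor≢x k)
  one-distinct′ {fsuc j} {fzero}  _   j≡x = contradiction j≡x (factor≢x j)
  one-distinct′ {fsuc j} {fsuc k} j~0 j≡k = cong fsuc (one-distinct (one-Q⇒P (factor≢x j) j~0) j≡k)

  one-descends′ : ∀ {j k} → MeetsOne (x ∷ xs) j →
                  prod (x ∷ xs) (lookup (x ∷ xs) j) ≡ lookup (x ∷ xs) k → k < j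
  one-descends′ {fzero}  {k}      _ Qx≡k = contradiction (trans (sym Qx≡k) Qx≡0) (factor≢0 k)
  one-descends′ {fsuc j} {fzero}  _ _    = s≤s z≤n
  one-descends′ {fsuc j} {fsuc k} j~0 Qj≡k with star-view x (P (lookup xs j))
  ... | at-one _ Qj≡x    = contradiction (trans (sym Qj≡k) Qj≡x) (factor≢x k)
  ... | at-i Pj≡x _      = contradiction (P-inj (trans Pj≡x (sym x-fixed))) (factor≢x j)
  ... | fixed _ _ Qj≡Pj = s≤s (one-descends (one-Q⇒P (factor≢x j) j~0) (trans (sym Qj≡Pj) Qj≡k))

  nested-∷ : Nested (x ∷ xs)
  nested-∷ = record
    { nested = nested′ ; before-one = before-one′ ; one-distinct = one-distinct′ ; one-descends = one-descends′ }

module CutStep {n : ℕ} {x : Fin (suc n)} {xs : List (Fin (suc n))}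
               (xs≢0 : All (_≢ fzero) xs) (x∈xs : x ∈ xs) (one~x : Orbit (prod xs) fzero x)
               (ih : Nested xs) where

  open Nested ih
  open LeftStar (prod xs) (prod-injective xs) x using (Q; Q-inj; P-to-Q; Q-to-P; away-P⇒Q)

  private
    P : Fin (suc n) → Fin (suc n)
    P = prod xs
    P-inj : Injective _≡_ _≡_ P
    P-inj = prod-injective xs
    p : Fin (length xs)
    p = Any.index x∈xs

  x≡p : x ≡ lookup xs p
  x≡p = lookup-index x∈xs

  factor≢0 : ∀ k → lookup (x ∷ xs) k ≢ fzero
  factor≢0 k = All.lookup (All.lookup xs≢0 x∈xs ∷ xs≢0) (∈-lookup k)

  x~one : Orbit P x fzero
  x~one = orbit-sym P-inj one~x

  Q⇒P : ∀ {u v} → Orbit Q u v → Orbit P u v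
  Q⇒P u~v with Q-to-P u~v | Q-to-P (orbit-sym Q-inj u~v)
  ... | inj₁ u~v′   | _           = u~v′
  ... | inj₂ _      | inj₁ v~u    = orbit-sym P-inj v~u
  ... | inj₂ u~0∨x | inj₂ v~0∨x = orbit-trans (via-x u~0∨x) (orbit-sym P-inj (via-x v~0∨x))
    where
      via-x : ∀ {w} → Orbit P w fzero ⊎ Orbit P w x → Orbit P w fzero
      via-x = [ id , (λ w~x → orbit-trans w~x x~one) ]′

  one-splits : ∀ {w} → Orbit P w fzero → Orbit Q w fzero ⊎ Orbit Q w x
  one-splits w~0 = [ inj₁ , id ]′ (P-to-Q w~0)

  off-one : ∀ {w v} → ¬ Orbit P w fzero → Orbit P w v → Orbit Q w v
  off-one w≁0 = away-P⇒Q w≁0 (λ w~x → w≁0 (orbit-trans w~x x~one))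

  off-one-≁x : ∀ {w} → ¬ Orbit P w fzero → ¬ Orbit Q w x
  off-one-≁x w≁0 w~x = w≁0 (orbit-trans (Q⇒P w~x) x~one)

  -- Closed under Q by one-descends, hence it contains the whole Q-cycle of x.
  EarlyOnOne : Fin (suc n) → Set
  EarlyOnOne w = Orbit P w fzero × ∃ λ k → lookup xs k ≡ w × k ≤ p

  early-x : EarlyOnOne x
  early-x = x~one , p , sym x≡p , ≤-refl

  early≢0 : ¬ EarlyOnOne fzero
  early≢0 (_ , k , k≡0 , _) = factor≢0 (fsuc k) k≡0

  early-closed : ∀ {w} → EarlyOnOne w → EarlyOnOne (Q w)
  early-closed {w} (w~0 , k , k≡w , k≤p) with star-view x (P w)
  ... | at-one _ Qw≡x    = subst EarlyOnOne (sym Qw≡x) early-x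
  ... | at-i Pw≡x _      = contradiction k≤p (<⇒≱ (one-descends k~0 (trans (cong P k≡w) (trans Pw≡x x≡p))))
    where
      k~0 : Orbit P (lookup xs k) fzero
      k~0 = subst (λ v → Orbit P v fzero) (sym k≡w) w~0
  ... | fixed Pw≢0 _ Qw≡Pw =
    subst EarlyOnOne (sym Qw≡Pw) (Pw~0 , k′ , sym Pw≡k′ , <⇒≤ (<-≤-trans k′<k k≤p))
    where
      k~0 : Orbit P (lookup xs k) fzero
      k~0 = subst (λ v → Orbit P v fzero) (sym k≡w) w~0
      Pw~0 : Orbit P (P w) fzero
      Pw~0 = orbit-trans (orbit-sym P-inj (orbit-step refl)) w~0
      Pw∈xs : P w ∈ xs
      Pw∈xs = one-cycle⊆factors xs Pw≢0 Pw~0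
      k′ : Fin (length xs)
      k′ = Any.index Pw∈xs
      Pw≡k′ : P w ≡ lookup xs k′
      Pw≡k′ = lookup-index Pw∈xs
      k′<k : k′ < k
      k′<k = one-descends k~0 (trans (cong P k≡w) Pw≡k′)

  x≁one : ¬ Orbit Q x fzero
  x≁one x~0 = early≢0 (orbit-closed EarlyOnOne early-closed early-x x~0)

  x-cycle-early : ∀ k → Orbit Q (lookup xs k) x → k ≤ p
  x-cycle-early k k~x with orbit-closed EarlyOnOne early-closed early-x (orbit-sym Q-inj k~x)
  ... | k~0 , k₀ , k₀≡k , k₀≤p = subst (_≤ p) (one-distinct k₀~0 k₀≡k) k₀≤p
    where
      k₀~0 : Orbit P (lookup xs k₀) fzero
      k₀~0 = subst (λ v → Orbit P v fzero) (sym k₀≡k) k~0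

  one-cycle-late : ∀ k → Orbit Q (lookup xs k) fzero → p < k
  one-cycle-late k k~0 with k ≤? p
  ... | yes k≤p = contradiction (orbit-closed EarlyOnOne early-closed (Q⇒P k~0 , k , refl , k≤p) k~0) early≢0
  ... | no k≰p  = ≰⇒> k≰p

  nested-off-one : ∀ {a c b} → a < c → c < b → ShareCycle (x ∷ xs) a b → ¬ ShareCycle (x ∷ xs) a c →
                   ¬ Orbit P (lookup (x ∷ xs) c) fzero
  nested-off-one {fzero}  {fzero}           ()
  nested-off-one {fsuc _} {fzero}           ()
  nested-off-one {_}      {fsuc _} {fzero}  _ ()
  nested-off-one {fzero}  {fsuc c} {fsuc b} _ (s≤s c<b) x~b x≁c c~0 with one-splits c~0
  ... | inj₁ c~0′ = <⇒≱ (<-trans (one-cycle-late c c~0′) c<b) (x-cycle-early b (orbit-sym Q-inj x~b))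
  ... | inj₂ c~x  = x≁c (orbit-sym Q-inj c~x)
  nested-off-one {fsuc a} {fsuc c} {fsuc b} (s≤s a<c) (s≤s c<b) a~b a≁c c~0 with orbit? P-inj (lookup xs a) fzero
  ... | no a≁0  = proj₁ (nested a<c c<b (Q⇒P a~b) (λ a~c → a≁0 (orbit-trans a~c c~0))) c~0
  ... | yes a~0 with one-splits a~0 | one-splits c~0
  ...   | inj₁ a~0′ | inj₁ c~0′ = a≁c (orbit-trans a~0′ (orbit-sym Q-inj c~0′))
  ...   | inj₁ a~0′ | inj₂ c~x  = <⇒≱ (<-trans (one-cycle-late a a~0′) a<c) (x-cycle-early c c~x)
  ...   | inj₂ a~x  | inj₁ c~0′ =
    <⇒≱ (<-trans (one-cycle-late c c~0′) c<b) (x-cycle-early b (orbit-trans (orbit-sym Q-inj a~b) a~x))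
  ...   | inj₂ a~x  | inj₂ c~x  = a≁c (orbit-trans a~x (orbit-sym Q-inj c~x))

  nested′ : ∀ {a c b} → a < c → c < b → ShareCycle (x ∷ xs) a b → ¬ ShareCycle (x ∷ xs) a c →
            ¬ MeetsOne (x ∷ xs) c × (∀ j → ShareCycle (x ∷ xs) c j → a < j × j < b)
  nested′ {fzero}  {fzero}           ()
  nested′ {fsuc _} {fzero}           ()
  nested′ {_}      {fsuc _} {fzero}  _ ()
  nested′ {a@fzero} {fsuc c} {fsuc b} a<c c<b@(s≤s c<b′) x~b x≁c = c≁0 ∘ Q⇒P , within
    where
      c≁0 : ¬ MeetsOne xs c
      c≁0 = nested-off-one a<c c<b x~b x≁c
      b~0 : Orbit P (lookup xs b) fzero
      b~0 = orbit-trans (Q⇒P (orbit-sym Q-inj x~b)) x~one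
      within : ∀ j → ShareCycle (x ∷ xs) (fsuc c) j → a < j × j < fsuc b
      within fzero    c~x = contradiction c~x (off-one-≁x c≁0)
      within (fsuc j) c~j = s≤s z≤n , s≤s (before-one c<b′ b~0 c≁0 j (Q⇒P c~j))
  nested′ {fsuc a} {fsuc c} {fsuc b} a<c@(s≤s a<c′) c<b@(s≤s c<b′) a~b a≁c = c≁0 ∘ Q⇒P , within
    where
      c≁0 : ¬ MeetsOne xs c
      c≁0 = nested-off-one a<c c<b a~b a≁c
      c≁0,within : ¬ MeetsOne xs c × (∀ j → ShareCycle xs c j → a < j × j < b)
      c≁0,within = nested a<c′ c<b′ (Q⇒P a~b)
                          λ a~c → a≁c (orbit-sym Q-inj (off-one c≁0 (orbit-sym P-inj a~c)))
      within : ∀ j → ShareCycle (x ∷ xs) (fsuc c) j → fsuc a < j × j < fsuc b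
      within fzero    c~x = contradiction c~x (off-one-≁x c≁0)
      within (fsuc j) c~j = Product.map s≤s s≤s (proj₂ c≁0,within j (Q⇒P c~j))

  x-cycle-before : ∀ b → Orbit Q (lookup xs b) fzero → ∀ j → Orbit Q (lookup (x ∷ xs) j) x → j < fsuc b
  x-cycle-before b b~0 fzero    _   = s≤s z≤n
  x-cycle-before b b~0 (fsuc j) j~x = s≤s (≤-<-trans (x-cycle-early j j~x) (one-cycle-late b b~0))

  before-one′ : ∀ {c b} → c < b → MeetsOne (x ∷ xs) b → ¬ MeetsOne (x ∷ xs) c →
                ∀ j → ShareCycle (x ∷ xs) c j → j < b
  before-one′ {_}      {fzero}  ()
  before-one′ {fzero}  {fsuc b} _ b~0 _ j x~j = x-cycle-before b b~0 j (orbit-sym Q-inj x~j)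
  before-one′ {fsuc c} {fsuc b} (s≤s c<b) b~0 c≁0 j c~j with orbit? P-inj (lookup xs c) fzero
  ... | yes c~0 = [ (λ c~0′ → contradiction c~0′ c≁0)
                  , (λ c~x → x-cycle-before b b~0 j (orbit-trans (orbit-sym Q-inj c~j) c~x)) ]′ (one-splits c~0)
  before-one′ {fsuc c} {fsuc b} (s≤s c<b) b~0 c≁0 fzero    c~x | no c≁0′ =
    contradiction c~x (off-one-≁x c≁0′)
  before-one′ {fsuc c} {fsuc b} (s≤s c<b) b~0 c≁0 (fsuc j) c~j | no c≁0′ =
    s≤s (before-one c<b (Q⇒P b~0) c≁0′ j (Q⇒P c~j))

  one-distinct′ : ∀ {j k} → MeetsOne (x ∷ xs) j → lookup (x ∷ xs) j ≡ lookup (x ∷ xs) k → j ≡ k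
  one-distinct′ {fzero}           x~0 _   = contradiction x~0 x≁one
  one-distinct′ {fsuc j} {fzero}  j~0 j≡x = contradiction (subst (λ v → Orbit Q v fzero) j≡x j~0) x≁one
  one-distinct′ {fsuc j} {fsuc k} j~0 j≡k = cong fsuc (one-distinct (Q⇒P j~0) j≡k)

  one-descends′ : ∀ {j k} → MeetsOne (x ∷ xs) j →
                  prod (x ∷ xs) (lookup (x ∷ xs) j) ≡ lookup (x ∷ xs) k → k < j
  one-descends′ {fzero} x~0 _ = contradiction x~0 x≁one
  one-descends′ {fsuc j} {k} j~0 Qj≡k with star-view x (P (lookup xs j))
  ... | at-one _ Qj≡x = contradiction (orbit-trans (orbit-sym Q-inj (orbit-step Qj≡x)) j~0) x≁one
  ... | at-i _ Qj≡0   = contradiction (trans (sym Qj≡k) Qj≡0) (factor≢0 k)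
  one-descends′ {fsuc j} {fzero}  j~0 Qj≡x | fixed _ Pj≢x Qj≡Pj = contradiction (trans (sym Qj≡Pj) Qj≡x) Pj≢x
  one-descends′ {fsuc j} {fsuc k} j~0 Qj≡k | fixed _ _ Qj≡Pj =
    s≤s (one-descends (Q⇒P j~0) (trans (sym Qj≡Pj) Qj≡k))

  nested-∷ : Nested (x ∷ xs)
  nested-∷ = record
    { nested = nested′ ; before-one = before-one′ ; one-distinct = one-distinct′ ; one-descends = one-descends′ }

module _ {n : ℕ} where
  open DecMembership (_≟_ {suc n}) using (_∈?_)

  repeatsCut⇒nested : ∀ {xs : List (Fin (suc n))} → All (_≢ fzero) xs → RepeatsCut xs → Nested xs
  repeatsCut⇒nested {[]}     []           []           = nested-[]
  repeatsCut⇒nested {x ∷ xs} (x≢0 ∷ xs≢0) (cuts ∷ rc) with x ∈? xs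
  ... | yes x∈xs = CutStep.nested-∷ xs≢0 x∈xs (cuts x∈xs) (repeatsCut⇒nested xs≢0 rc)
  ... | no x∉xs  = JoinStep.nested-∷ x≢0 xs≢0 x∉xs (repeatsCut⇒nested xs≢0 rc)

-- Minimal transitive star factorizations

module _ {n : ℕ} (π : Permutation′ (suc n)) {g : Fin (suc n) → Fin (suc n)}
         (π≗g : ∀ j → π ⟨$⟩ʳ j ≡ g j) where

  iter≗^ : ∀ t y → iter π t y ≡ (g ^ t) y
  iter≗^ zero    y = refl
  iter≗^ (suc t) y = trans (π≗g _) (cong g (iter≗^ t y))

  sameCycle⇒orbit : ∀ {y z} → SameCycle π y z → Orbit g y z
  sameCycle⇒orbit (t , πᵗy≡z) = t , trans (sym (iter≗^ t _)) πᵗy≡z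

  orbit⇒sameCycle : ∀ {y z} → Orbit g y z → SameCycle π y z
  orbit⇒sameCycle (t , gᵗy≡z) = t , trans (iter≗^ t _) gᵗy≡z

  numCycles≤cycleCount : numCycles π ℕ.≤ cycleCount g
  numCycles≤cycleCount = count-mono (isCycleMin? π) (isOrbitMin? g) {allFin (suc n)}
    (All.tabulate λ {y} _ min t → subst (toℕ y ℕ.≤_) (cong toℕ (iter≗^ (toℕ t) y)) (min t))

numCycles-positive : ∀ {n} (π : Permutation′ (suc n)) → 1 ℕ.≤ numCycles π
numCycles-positive π = filter-some (isCycleMin? π) (here λ _ → z≤n)

module _ {n : ℕ} where
  open DecMembership (_≟_ {suc n}) using (_∈?_)

  reach-from-one : ∀ {f : List (Fin (suc n))} {y} → Reach f fzero y → y ≡ fzero ⊎ y ∈ f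
  reach-from-one here = inj₁ refl
  reach-from-one {f} (step {y} {i} r i∈f) with star-view i y
  ... | at-one _ s    = inj₂ (subst (_∈ f) (sym s) i∈f)
  ... | at-i _ s      = inj₁ s
  ... | fixed y≢0 _ s =
    inj₂ (subst (_∈ f) (sym s) ([ (λ y≡0 → contradiction y≡0 y≢0) , id ]′ (reach-from-one r)))

  private
    nonzero? : (y : Fin (suc n)) → Dec (y ≢ fzero)
    nonzero? y = ¬? (y ≟ fzero)

  nonzero-count : count nonzero? (allFin (suc n)) ≡ n
  nonzero-count = begin
    count nonzero? (fzero ∷ tabulate fsuc)
      ≡⟨ cong length (filter-reject nonzero? {xs = tabulate fsuc} (λ 0≢0 → 0≢0 refl)) ⟩
    count nonzero? (tabulate fsuc)
      ≡⟨ cong length (filter-all nonzero? {xs = tabulate fsuc} (tabulate⁺ λ _ ())) ⟩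
    length (tabulate {n = n} fsuc)
      ≡⟨ length-tabulate fsuc ⟩
    n ∎
    where open ≡-Reasoning

  transitive⇒support : ∀ {f : List (Fin (suc n))} → Transitive f → n ℕ.≤ support f
  transitive⇒support {f} transitive = begin
    n                               ≡⟨ nonzero-count ⟨
    count nonzero? (allFin (suc n))
      ≤⟨ count-mono nonzero? (_∈? f) {allFin (suc n)} (All.tabulate λ _ → reached _) ⟩
    support f                       ∎
    where
      open ≤-Reasoning
      reached : ∀ y → y ≢ fzero → y ∈ f
      reached y y≢0 = [ (λ y≡0 → contradiction y≡0 y≢0) , id ]′ (reach-from-one (transitive fzero y))

  private
    1+n+[n+m]≡1+m+[n+n] : ∀ n m → suc n + (n + m) ≡ suc m + (n + n)
    1+n+[n+m]≡1+m+[n+n] = solve-∀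

  minimal-length : ∀ {m} → 1 ℕ.≤ m → suc n + (suc n + m ∸ 2) ≡ m + (n + n)
  minimal-length {suc m} _ = trans (cong (λ k → suc n + (k ∸ 1)) (+-suc n m)) (1+n+[n+m]≡1+m+[n+n] n m)

  minimal⇒tight : (π : Permutation′ (suc n)) (f : List (Fin (suc n))) → (∀ j → π ⟨$⟩ʳ j ≡ prod f j) →
                  Transitive f → length f ≡ suc n + numCycles π ∸ 2 → suc n + length f ℕ.≤ weight f
  minimal⇒tight π f π≗f transitive length≡ = begin
    suc n + length f                  ≡⟨ cong (suc n +_) length≡ ⟩
    suc n + (suc n + numCycles π ∸ 2) ≡⟨ minimal-length (numCycles-positive π) ⟩
    numCycles π + (n + n)             ≤⟨ +-mono-≤ (numCycles≤cycleCount π π≗f) (+-mono-≤ n≤s n≤s) ⟩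
    weight f                          ∎
    where
      open ≤-Reasoning
      n≤s : n ℕ.≤ support f
      n≤s = transitive⇒support transitive

lemma2p2 : (n : ℕ) (π : Permutation′ (suc n)) (f : List (Fin (suc n)))
    → All (_≢ fzero) f
    → (∀ j → π ⟨$⟩ʳ j ≡ prod f j)
    → Transitive f
    → length f ≡ suc n + numCycles π ∸ 2
    → (σ σ̂ : Fin (suc n))
    → ¬ SameCycle π σ σ̂
    → (a c b : Fin (length f))
    → a < c → c < b
    → Meets π (lookup f a) σ → Meets π (lookup f b) σ → Meets π (lookup f c) σ̂
    → ¬ SameCycle π σ̂ fzero
      × (∀ (j : Fin (length f)) → Meets π (lookup f j) σ̂ → a < j × j < b)
lemma2p2 n π f f≢0 π≗f transitive length≡ σ σ̂ σ≁σ̂ a c b a<c c<b σ~a σ~b σ̂~c =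
  proj₁ c-nested ∘ c~1 , λ j σ̂~j → proj₂ c-nested j (orbit-trans c~σ̂ (to-orbit σ̂~j))
  where
    open Nested (repeatsCut⇒nested f≢0 (tight⇒repeatsCut f≢0 (minimal⇒tight π f π≗f transitive length≡)))
    to-orbit : ∀ {y z} → SameCycle π y z → Orbit (prod f) y z
    to-orbit = sameCycle⇒orbit π π≗f
    c~σ̂ : Orbit (prod f) (lookup f c) σ̂
    c~σ̂ = orbit-sym (prod-injective f) (to-orbit σ̂~c)
    c~1 : SameCycle π σ̂ fzero → MeetsOne f c
    c~1 σ̂~1 = orbit-trans c~σ̂ (to-orbit σ̂~1)
    a~b : ShareCycle f a b
    a~b = orbit-trans (orbit-sym (prod-injective f) (to-orbit σ~a)) (to-orbit σ~b)
    a≁c : ¬ ShareCycle f a c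
    a≁c a~c = σ≁σ̂ (orbit⇒sameCycle π π≗f (orbit-trans (to-orbit σ~a) (orbit-trans a~c c~σ̂)))
    c-nested : ¬ MeetsOne f c × (∀ j → ShareCycle f c j → a < j × j < b)
    c-nested = nested a<c c<b a~b a≁c
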